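{- There exists a circle graph that is not $132$-representable.
   Context: All graphs are simple. A circle graph is a graph whose vertices can be associated with chords of a circle so that two chords intersect if and only if the corresponding vertices are adjacent. A word is a finite sequence $w=w_1w_2\cdots w_n$ of letters from a totally ordered alphabet. Two letters $x,y$ alternate in $w$ if (after deleting all other letters) between any two occurrences of $x$ there is an occurrence of $y$ and between any two occurrences of $y$ there is an occurrence of $x$. A graph $G=(V,E)$ is represented by a word $w$ over $V$ if for all distinct $x,y\in V$, $x$ and $y$ alternate in $w$ if and only if $xy\in E$. A word $w$ contains a pattern $\tau=\tau_1\cdots\tau_k$ (a permutation) if some subsequence $w_{i_1}\cdots w_{i_k}$ ($i_1<\dots<i_k$) is order-isomorphic to $\tau$; otherwise $w$ avoids $\tau$. A graph is $\tau$-representable if, after labeling its vertices by distinct elements of a totally ordered set (any labeling may be chosen), it is represented by a word that avoids $\tau$. -}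

module Defs where

open import Data.Nat using (ℕ; _<_)
open import Data.Fin using (Fin) renaming (_<_ to _<ᶠ_)
open import Data.List using (List; length; lookup)
open import Data.List.Membership.Propositional using (_∈_)
open import Data.Product using (Σ; _×_; ∃; ∃-syntax)
open import Relation.Binary.PropositionalEquality using (_≡_; _≢_)
open import Relation.Nullary using (¬_)
open import Function.Bundles using (_⇔_)
open import Function.Definitions using (Injective)

record Graph : Set₁ where
  field
    n     : ℕ
    Adj   : Fin n → Fin n → Set
    sym   : ∀ {x y} → Adj x y → Adj y x
    irrefl : ∀ {x} → ¬ Adj x x
open Graph public

-- Points on the circle are recorded by their position in the
-- cyclic order (a natural number); each vertex v gets a chord with endpoints
-- left v < right v, all 2n endpoints distinct.  Two chords with distinct
-- endpoints intersect iff their endpoints interleave.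
Interleave : ℕ → ℕ → ℕ → ℕ → Set
Interleave a b c d = (a < c × c < b × b < d) Data.Sum.⊎ (c < a × a < d × d < b)
  where import Data.Sum

record ChordModel (G : Graph) : Set where
  field
    left  : Fin (n G) → ℕ
    right : Fin (n G) → ℕ
    ordered : ∀ v → left v < right v
    left-inj  : Injective _≡_ _≡_ left
    right-inj : Injective _≡_ _≡_ right
    left-right-distinct : ∀ u v → left u ≢ right v
    correct : ∀ x y → x ≢ y →
      (Adj G x y ⇔ Interleave (left x) (right x) (left y) (right y))

IsCircleGraph : Graph → Set
IsCircleGraph G = ChordModel G

module _ {V : Set} where

  Separates : V → V → List V → Set
  Separates x y w = ∀ (i j : Fin (length w)) → i <ᶠ j →
    lookup w i ≡ x → lookup w j ≡ x →
    ∃[ k ] (i <ᶠ k × k <ᶠ j × lookup w k ≡ y)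

  Alternate : V → V → List V → Set
  Alternate x y w = Separates x y w × Separates y x w

  ContainsPattern : (V → ℕ) → List ℕ → List V → Set
  ContainsPattern ℓ τ w =
    Σ (Fin (length τ) → Fin (length w)) λ f →
      (∀ a b → a <ᶠ b → f a <ᶠ f b) ×
      (∀ a b → (ℓ (lookup w (f a)) < ℓ (lookup w (f b))) ⇔ (lookup τ a < lookup τ b))

  AvoidsPattern : (V → ℕ) → List ℕ → List V → Set
  AvoidsPattern ℓ τ w = ¬ ContainsPattern ℓ τ w

Represents : (G : Graph) → List (Fin (n G)) → Set
Represents G w = (∀ v → v ∈ w) ×
  (∀ x y → x ≢ y → (Alternate x y w ⇔ Adj G x y))

-- τ-representable: some injective labelling of the vertices by elements of a
-- totally ordered set (ℕ suffices: only the relative order on the finitely many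
-- vertices matters) and some representing word avoiding τ.
Representable : List ℕ → Graph → Set
Representable τ G =
  Σ (Fin (n G) → ℕ) λ ℓ → Injective _≡_ _≡_ ℓ ×
    ∃[ w ] (Represents G w × AvoidsPattern ℓ τ w)

pattern132 : List ℕ
pattern132 = 1 Data.List.∷ 3 Data.List.∷ 2 Data.List.∷ Data.List.[]
  where import Data.List

-- The witness is K₃,₃. Let M be its vertex of largest label. In a 132-avoiding word, two
-- distinct letters smaller than a letter Z cannot both occur on both sides of one occurrence
-- of Z. The three vertices a, b, c opposite M (labels increasing) alternate with M but not
-- with each other, so each of them that repeats straddles an occurrence of M. Hence M occurs
-- at most twice, and not once. If it occurs at m₁ < m₂, only c can straddle m₁ and only a
-- can straddle m₂; this confines the other two vertices p, q of M's side to (m₁, m₂), where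
-- each repeats around the unique occurrence of c in (m₁, m₂), so p and q straddle the same c.

module Submission where

open import Defs hiding (sym)
open import Data.Bool using (Bool; _≟_; if_then_else_)
open import Data.Bool.Properties using (¬-not)
open import Data.Nat using (ℕ; _<_; _∸_; _<ᵇ_; z<s; s<s)
open import Data.Nat.Properties using (_<?_)
import Data.Nat.Properties as ℕₚ
open import Data.Fin using (Fin; zero; suc; toℕ) renaming (_<_ to _<ᶠ_)
import Data.Fin.Properties as Finₚ
open import Data.List using (List; length; lookup; allFin)
open import Data.List.Extrema.Nat using (argmax; f[xs]≤f[argmax])
open import Data.List.Membership.Propositional using (_∈_)
open import Data.List.Membership.Propositional.Properties using (∈-allFin)
open import Data.List.Relation.Unary.All as All using ()
open import Data.List.Relation.Unary.Any using (index)
open import Data.List.Relation.Unary.Any.Properties using (lookup-index)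
open import Data.Product using (_×_; _,_; proj₁; proj₂; ∃; ∃₂; ∃-syntax)
open import Data.Sum using (_⊎_; inj₁; inj₂)
open import Data.Empty using (⊥; ⊥-elim)
open import Function.Bundles using (_⇔_; mk⇔; Equivalence)
open import Function.Definitions using (Injective)
open import Relation.Binary using (DecidableEquality; tri<; tri≈; tri>)
open import Relation.Binary.PropositionalEquality using (_≡_; _≢_; refl; sym; trans; cong; subst; ≢-sym)
open import Relation.Nullary using (¬_; Dec; yes; no)
open import Relation.Nullary.Decidable
  using (_×-dec_; _⊎-dec_; _→-dec_; ¬?; decidable-stable; from-yes)

module Occurrences {V : Set} (w : List V) where

  Pos : Set
  Pos = Fin (length w)

  w[_] : Pos → V
  w[ i ] = lookup w i

  Between : V → Pos → Pos → Set
  Between y i j = ∃[ k ] (i <ᶠ k × k <ᶠ j × w[ k ] ≡ y)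

  Straddles : V → Pos → Set
  Straddles x z = ∃₂ λ i j → i <ᶠ z × z <ᶠ j × w[ i ] ≡ x × w[ j ] ≡ x

  Repeated : V → Set
  Repeated x = ∃₂ λ i j → i <ᶠ j × w[ i ] ≡ x × w[ j ] ≡ x

  Unseparated : V → V → Set
  Unseparated x y = ∃₂ λ i j → i <ᶠ j × w[ i ] ≡ x × w[ j ] ≡ x × ¬ Between y i j

  NoThreeOccurrences : V → Set
  NoThreeOccurrences x = ∀ {z₁ z₂ z₃} → z₁ <ᶠ z₂ → z₂ <ᶠ z₃ →
    w[ z₁ ] ≡ x → w[ z₂ ] ≡ x → w[ z₃ ] ≡ x → ⊥

  OccursOnceAt : V → Pos → Set
  OccursOnceAt x m = w[ m ] ≡ x × (∀ z → w[ z ] ≡ x → z ≡ m)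

  OccursTwiceAt : V → Pos → Pos → Set
  OccursTwiceAt x m₁ m₂ =
    m₁ <ᶠ m₂ × w[ m₁ ] ≡ x × w[ m₂ ] ≡ x × (∀ z → w[ z ] ≡ x → z ≡ m₁ ⊎ z ≡ m₂)

  occurrence : ∀ {x} → x ∈ w → ∃[ i ] w[ i ] ≡ x
  occurrence x∈w = index x∈w , sym (lookup-index x∈w)

module DecidableOccurrences {V : Set} (_≟ᵥ_ : DecidableEquality V) (w : List V) where

  open Occurrences w

  between? : ∀ y i j → Dec (Between y i j)
  between? y i j = Finₚ.any? λ k → (i Finₚ.<? k) ×-dec (k Finₚ.<? j) ×-dec (w[ k ] ≟ᵥ y)

  separates-or-unseparated : ∀ x y → Separates x y w ⊎ Unseparated x y
  separates-or-unseparated x y with Finₚ.any? (λ i → Finₚ.any? λ j →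
      (i Finₚ.<? j) ×-dec (w[ i ] ≟ᵥ x) ×-dec (w[ j ] ≟ᵥ x) ×-dec ¬? (between? y i j))
  ... | yes (i , j , gap) = inj₂ (i , j , gap)
  ... | no no-gap = inj₁ λ i j i<j wi wj →
      decidable-stable (between? y i j) λ ¬b → no-gap (i , j , i<j , wi , wj , ¬b)

  ¬alternate⇒unseparated : ∀ {x y} → ¬ Alternate x y w → Unseparated x y ⊎ Unseparated y x
  ¬alternate⇒unseparated {x} {y} ¬alt
    with separates-or-unseparated x y | separates-or-unseparated y x
  ... | inj₂ u | _      = inj₁ u
  ... | inj₁ _ | inj₂ u = inj₂ u
  ... | inj₁ s | inj₁ t = ⊥-elim (¬alt (s , t))

  ¬alternate⇒repeated : ∀ {x y} → ¬ Alternate x y w → Repeated x ⊎ Repeated y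
  ¬alternate⇒repeated ¬alt with ¬alternate⇒unseparated ¬alt
  ... | inj₁ (i , j , i<j , wi , wj , _) = inj₁ (i , j , i<j , wi , wj)
  ... | inj₂ (i , j , i<j , wi , wj , _) = inj₂ (i , j , i<j , wi , wj)

  exactly-two : ∀ {x m₁ m₂} → NoThreeOccurrences x → m₁ <ᶠ m₂ → w[ m₁ ] ≡ x → w[ m₂ ] ≡ x →
    ∀ z → w[ z ] ≡ x → z ≡ m₁ ⊎ z ≡ m₂
  exactly-two {m₁ = m₁} {m₂} no-three m₁<m₂ e₁ e₂ z e with Finₚ.<-cmp z m₁ | Finₚ.<-cmp z m₂
  ... | tri≈ _ z≡m₁ _ | _             = inj₁ z≡m₁
  ... | _             | tri≈ _ z≡m₂ _ = inj₂ z≡m₂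
  ... | tri< z<m₁ _ _ | _             = ⊥-elim (no-three z<m₁ m₁<m₂ e e₁ e₂)
  ... | tri> _ _ m₁<z | tri< z<m₂ _ _ = ⊥-elim (no-three m₁<z z<m₂ e₁ e e₂)
  ... | tri> _ _ _    | tri> _ _ m₂<z = ⊥-elim (no-three m₁<m₂ m₂<z e₁ e₂ e)

  once-or-twice : ∀ {x} → x ∈ w → NoThreeOccurrences x →
    ∃ (OccursOnceAt x) ⊎ ∃₂ (OccursTwiceAt x)
  once-or-twice {x} x∈w no-three
    with occurrence x∈w
  ... | m , e with Finₚ.any? (λ j → (w[ j ] ≟ᵥ x) ×-dec ¬? (j Finₚ.≟ m))
  ... | no none = inj₁ (m , e , λ z e′ →
          decidable-stable (z Finₚ.≟ m) λ z≢m → none (z , e′ , z≢m))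
  ... | yes (j , e′ , j≢m) with Finₚ.<-cmp j m
  ... | tri< j<m _ _ = inj₂ (j , m , j<m , e′ , e , exactly-two no-three j<m e′ e)
  ... | tri≈ _ j≡m _ = ⊥-elim (j≢m j≡m)
  ... | tri> _ _ m<j = inj₂ (m , j , m<j , e , e′ , exactly-two no-three m<j e e′)

module Avoiding132 {V : Set} (ℓ : V → ℕ) (ℓ-inj : Injective _≡_ _≡_ ℓ) (w : List V)
  (avoid : AvoidsPattern ℓ pattern132 w) where

  open Occurrences w

  no-132 : ∀ {i j k} → i <ᶠ j → j <ᶠ k →
    ℓ w[ i ] < ℓ w[ k ] → ℓ w[ k ] < ℓ w[ j ] → ⊥
  no-132 {i} {j} {k} i<j j<k ℓi<ℓk ℓk<ℓj = avoid (occurrence-of , increasing , order-isomorphic)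
    where
    occurrence-of : Fin 3 → Pos
    occurrence-of zero             = i
    occurrence-of (suc zero)       = j
    occurrence-of (suc (suc zero)) = k

    increasing : ∀ a b → a <ᶠ b → occurrence-of a <ᶠ occurrence-of b
    increasing zero             (suc zero)       _ = i<j
    increasing zero             (suc (suc zero)) _ = Finₚ.<-trans i<j j<k
    increasing (suc zero)       (suc (suc zero)) _ = j<k
    increasing zero             zero             ()
    increasing (suc zero)       zero             ()
    increasing (suc zero)       (suc zero)       (s<s ())
    increasing (suc (suc zero)) zero             ()
    increasing (suc (suc zero)) (suc zero)       (s<s ())
    increasing (suc (suc zero)) (suc (suc zero)) (s<s (s<s ()))

    both : ∀ {P Q : Set} → P → Q → P ⇔ Q
    both p q = mk⇔ (λ _ → q) (λ _ → p)

    neither : ∀ {P Q : Set} → ¬ P → ¬ Q → P ⇔ Q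
    neither ¬p ¬q = mk⇔ (λ p → ⊥-elim (¬p p)) (λ q → ⊥-elim (¬q q))

    irreflexive : ∀ {n} → ¬ n < n
    irreflexive = ℕₚ.<-irrefl refl

    ℓi<ℓj : ℓ w[ i ] < ℓ w[ j ]
    ℓi<ℓj = ℕₚ.<-trans ℓi<ℓk ℓk<ℓj

    order-isomorphic : ∀ a b →
      ℓ w[ occurrence-of a ] < ℓ w[ occurrence-of b ] ⇔ lookup pattern132 a < lookup pattern132 b
    order-isomorphic zero             zero             = neither irreflexive irreflexive
    order-isomorphic zero             (suc zero)       = both ℓi<ℓj (s<s z<s)
    order-isomorphic zero             (suc (suc zero)) = both ℓi<ℓk (s<s z<s)
    order-isomorphic (suc zero)       zero             = neither (ℕₚ.<-asym ℓi<ℓj) λ { (s<s ()) }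
    order-isomorphic (suc zero)       (suc zero)       = neither irreflexive irreflexive
    order-isomorphic (suc zero)       (suc (suc zero)) = neither (ℕₚ.<-asym ℓk<ℓj) λ { (s<s (s<s ())) }
    order-isomorphic (suc (suc zero)) zero             = neither (ℕₚ.<-asym ℓi<ℓk) λ { (s<s ()) }
    order-isomorphic (suc (suc zero)) (suc zero)       = both ℓk<ℓj (s<s (s<s z<s))
    order-isomorphic (suc (suc zero)) (suc (suc zero)) = neither irreflexive irreflexive

  descending-around-peak : ∀ {i j k x z y} → w[ i ] ≡ x → w[ j ] ≡ z → w[ k ] ≡ y →
    i <ᶠ j → j <ᶠ k → ℓ x < ℓ z → ℓ y < ℓ z → x ≢ y → ℓ y < ℓ x
  descending-around-peak {i} {j} {k} refl refl refl i<j j<k x<z y<z x≢y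
    with ℕₚ.<-cmp (ℓ w[ i ]) (ℓ w[ k ])
  ... | tri< x<y _ _ = ⊥-elim (no-132 i<j j<k x<y y<z)
  ... | tri≈ _ x≡y _ = ⊥-elim (x≢y (ℓ-inj x≡y))
  ... | tri> _ _ y<x = y<x

  no-two-lower-straddlers : ∀ {x y z Z} → Straddles x z → Straddles y z → w[ z ] ≡ Z →
    ℓ x < ℓ Z → ℓ y < ℓ Z → x ≢ y → ⊥
  no-two-lower-straddlers (i , j , i<z , z<j , wi , wj) (i′ , j′ , i′<z , z<j′ , wi′ , wj′) wz
    x<Z y<Z x≢y =
    ℕₚ.<-asym (descending-around-peak wi wz wj′ i<z z<j′ x<Z y<Z x≢y)
              (descending-around-peak wi′ wz wj i′<z z<j y<Z x<Z (λ y≡x → x≢y (sym y≡x)))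

two-of-three : ∀ {A B C : Set} → A ⊎ B → B ⊎ C → A ⊎ C → (A × B) ⊎ (B × C) ⊎ (A × C)
two-of-three (inj₁ a) (inj₁ b) _        = inj₁ (a , b)
two-of-three (inj₁ a) (inj₂ c) _        = inj₂ (inj₂ (a , c))
two-of-three (inj₂ b) (inj₂ c) _        = inj₂ (inj₁ (b , c))
two-of-three (inj₂ b) (inj₁ _) (inj₁ a) = inj₁ (a , b)
two-of-three (inj₂ b) (inj₁ _) (inj₂ c) = inj₂ (inj₁ (b , c))

module CompleteBipartite {V : Set} (_≟ᵥ_ : DecidableEquality V) (side : V → Bool)
  (ℓ : V → ℕ) (ℓ-inj : Injective _≡_ _≡_ ℓ) (w : List V) (occurs : ∀ v → v ∈ w)
  (alternate⇔ : ∀ x y → x ≢ y → Alternate x y w ⇔ side x ≢ side y)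
  (avoid : AvoidsPattern ℓ pattern132 w) where

  open Occurrences w
  open DecidableOccurrences _≟ᵥ_ w
  open Avoiding132 ℓ ℓ-inj w avoid

  alternate : ∀ {x y} → side x ≢ side y → Alternate x y w
  alternate {x} {y} sx≢sy =
    Equivalence.from (alternate⇔ x y λ { refl → sx≢sy refl }) sx≢sy

  ¬alternate : ∀ {x y} → x ≢ y → side x ≡ side y → ¬ Alternate x y w
  ¬alternate {x} {y} x≢y sx≡sy alt = Equivalence.to (alternate⇔ x y x≢y) alt sx≡sy

  label-<⇒≢ : ∀ {x y} → ℓ x < ℓ y → x ≢ y
  label-<⇒≢ ℓx<ℓy x≡y = ℕₚ.<⇒≢ ℓx<ℓy (cong ℓ x≡y)

  module Configuration {M a b c p q : V}
    (M-max : ∀ v → v ≢ M → ℓ v < ℓ M)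
    (ℓa<ℓb : ℓ a < ℓ b) (ℓb<ℓc : ℓ b < ℓ c)
    (a-opp : side a ≢ side M) (b-opp : side b ≢ side M) (c-opp : side c ≢ side M)
    (p≢q : p ≢ q) (p≢M : p ≢ M) (q≢M : q ≢ M)
    (p-same : side p ≡ side M) (q-same : side q ≡ side M) where

    opposite⇒≢M : ∀ {x} → side x ≢ side M → x ≢ M
    opposite⇒≢M sx≢sM refl = sx≢sM refl

    opposite-sides : ∀ {v x} → side v ≡ side M → side x ≢ side M → side x ≢ side v
    opposite-sides sv≡sM sx≢sM sx≡sv = sx≢sM (trans sx≡sv sv≡sM)

    mate≢opposite : ∀ {v x} → side v ≡ side M → side x ≢ side M → v ≢ x
    mate≢opposite sv≡sM sx≢sM refl = sx≢sM sv≡sM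

    opposites-same-side : ∀ {x y} → side x ≢ side M → side y ≢ side M → side x ≡ side y
    opposites-same-side sx≢sM sy≢sM = trans (¬-not sx≢sM) (sym (¬-not sy≢sM))

    ℓa<ℓc : ℓ a < ℓ c
    ℓa<ℓc = ℕₚ.<-trans ℓa<ℓb ℓb<ℓc

    a≢b : a ≢ b
    a≢b = label-<⇒≢ ℓa<ℓb
    b≢c : b ≢ c
    b≢c = label-<⇒≢ ℓb<ℓc
    a≢c : a ≢ c
    a≢c = label-<⇒≢ ℓa<ℓc

    a≢M : a ≢ M
    a≢M = opposite⇒≢M a-opp
    b≢M : b ≢ M
    b≢M = opposite⇒≢M b-opp
    c≢M : c ≢ M
    c≢M = opposite⇒≢M c-opp

    no-two-straddlers-of-M : ∀ {x y z} → Straddles x z → Straddles y z → w[ z ] ≡ M →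
      x ≢ M → y ≢ M → x ≢ y → ⊥
    no-two-straddlers-of-M sx sy wz x≢M y≢M =
      no-two-lower-straddlers sx sy wz (M-max _ x≢M) (M-max _ y≢M)

    opposites-repeat : ∀ {x y} → x ≢ y → side x ≢ side M → side y ≢ side M →
      Repeated x ⊎ Repeated y
    opposites-repeat x≢y sx≢sM sy≢sM =
      ¬alternate⇒repeated (¬alternate x≢y (opposites-same-side sx≢sM sy≢sM))

    -- x alternates with M, so any two occurrences of x enclose an M.
    repeated⇒straddles-M : ∀ {x} → Repeated x → side x ≢ side M →
      ∃[ z ] (w[ z ] ≡ M × Straddles x z)
    repeated⇒straddles-M (i , j , i<j , wi , wj) sx≢sM
      with proj₁ (alternate sx≢sM) i j i<j wi wj
    ... | z , i<z , z<j , wz = z , wz , i , j , i<z , z<j , wi , wj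

    M-occurs-at-most-twice : NoThreeOccurrences M
    M-occurs-at-most-twice {z₂ = z₂} z₁<z₂ z₂<z₃ w₁ w₂ w₃ =
      no-two-straddlers-of-M (straddles a-opp) (straddles c-opp) w₂ a≢M c≢M a≢c
      where
      straddles : ∀ {x} → side x ≢ side M → Straddles x z₂
      straddles sx≢sM with proj₂ (alternate sx≢sM) _ _ z₁<z₂ w₁ w₂
                         | proj₂ (alternate sx≢sM) _ _ z₂<z₃ w₂ w₃
      ... | i , _ , i<z₂ , wi | j , z₂<j , _ , wj = i , j , i<z₂ , z₂<j , wi , wj

    module Once {m} (once : OccursOnceAt M m) where

      repeated⇒straddles-m : ∀ {x} → Repeated x → side x ≢ side M → Straddles x m
      repeated⇒straddles-m {x} r sx≢sM with repeated⇒straddles-M r sx≢sM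
      ... | z , wz , s = subst (Straddles x) (proj₂ once z wz) s

      no-two-repeated-opposites : ∀ {x y} → Repeated x → side x ≢ side M →
        Repeated y → side y ≢ side M → x ≢ y → ⊥
      no-two-repeated-opposites rx sx≢sM ry sy≢sM = no-two-straddlers-of-M
        (repeated⇒straddles-m rx sx≢sM) (repeated⇒straddles-m ry sy≢sM) (proj₁ once)
        (opposite⇒≢M sx≢sM) (opposite⇒≢M sy≢sM)

      impossible : ⊥
      impossible with two-of-three (opposites-repeat a≢b a-opp b-opp)
                                   (opposites-repeat b≢c b-opp c-opp)
                                   (opposites-repeat a≢c a-opp c-opp)
      ... | inj₁ (ra , rb)        = no-two-repeated-opposites ra a-opp rb b-opp a≢b
      ... | inj₂ (inj₁ (rb , rc)) = no-two-repeated-opposites rb b-opp rc c-opp b≢c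
      ... | inj₂ (inj₂ (ra , rc)) = no-two-repeated-opposites ra a-opp rc c-opp a≢c

    module Twice {m₁ m₂} (m₁<m₂ : m₁ <ᶠ m₂) (wm₁ : w[ m₁ ] ≡ M) (wm₂ : w[ m₂ ] ≡ M)
      (only : ∀ z → w[ z ] ≡ M → z ≡ m₁ ⊎ z ≡ m₂) where

      Inside : Pos → Set
      Inside z = m₁ <ᶠ z × z <ᶠ m₂

      inside-between : ∀ {r γ s} → Inside r → r <ᶠ γ → γ <ᶠ s → Inside s → Inside γ
      inside-between (m₁<r , _) r<γ γ<s (_ , s<m₂) =
        Finₚ.<-trans m₁<r r<γ , Finₚ.<-trans γ<s s<m₂

      not-at-m₁ : ∀ {z v} → w[ z ] ≡ v → v ≢ M → z ≢ m₁
      not-at-m₁ wz v≢M refl = v≢M (trans (sym wz) wm₁)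

      not-at-m₂ : ∀ {z v} → w[ z ] ≡ v → v ≢ M → z ≢ m₂
      not-at-m₂ wz v≢M refl = v≢M (trans (sym wz) wm₂)

      no-M-inside : ∀ {z} → Inside z → w[ z ] ≢ M
      no-M-inside (m₁<z , z<m₂) wz with only _ wz
      ... | inj₁ refl = Finₚ.<-irrefl refl m₁<z
      ... | inj₂ refl = Finₚ.<-irrefl refl z<m₂

      opposite-inside : ∀ {x} → side x ≢ side M → Between x m₁ m₂
      opposite-inside sx≢sM = proj₂ (alternate sx≢sM) m₁ m₂ m₁<m₂ wm₁ wm₂

      opposite-once-inside : ∀ {x γ γ′} → side x ≢ side M → w[ γ ] ≡ x → w[ γ′ ] ≡ x →
        m₁ <ᶠ γ → γ <ᶠ γ′ → γ′ <ᶠ m₂ → ⊥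
      opposite-once-inside sx≢sM wγ wγ′ m₁<γ γ<γ′ γ′<m₂
        with proj₁ (alternate sx≢sM) _ _ γ<γ′ wγ wγ′
      ... | z , γ<z , z<γ′ , wz =
            no-M-inside (Finₚ.<-trans m₁<γ γ<z , Finₚ.<-trans z<γ′ γ′<m₂) wz

      opposite-inside-unique : ∀ {x γ γ′} → side x ≢ side M → w[ γ ] ≡ x → w[ γ′ ] ≡ x →
        Inside γ → Inside γ′ → γ ≡ γ′
      opposite-inside-unique {γ = γ} {γ′} sx≢sM wγ wγ′ (m₁<γ , γ<m₂) (m₁<γ′ , γ′<m₂)
        with Finₚ.<-cmp γ γ′
      ... | tri≈ _ γ≡γ′ _ = γ≡γ′
      ... | tri< γ<γ′ _ _ = ⊥-elim (opposite-once-inside sx≢sM wγ wγ′ m₁<γ γ<γ′ γ′<m₂)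
      ... | tri> _ _ γ′<γ = ⊥-elim (opposite-once-inside sx≢sM wγ′ wγ m₁<γ′ γ′<γ γ<m₂)

      repeated⇒straddles-m₁-or-m₂ : ∀ {x} → Repeated x → side x ≢ side M →
        Straddles x m₁ ⊎ Straddles x m₂
      repeated⇒straddles-m₁-or-m₂ r sx≢sM with repeated⇒straddles-M r sx≢sM
      ... | z , wz , s with only z wz
      ... | inj₁ refl = inj₁ s
      ... | inj₂ refl = inj₂ s

      -- Since c occurs between m₁ and m₂, straddling m₁ puts a letter above c in the order of
      -- labels; dually, straddling m₂ puts it below a.
      ¬straddles-m₁ : ∀ {x} → Straddles x m₁ → side x ≢ side M → ℓ x < ℓ c → ⊥
      ¬straddles-m₁ (i , _ , i<m₁ , _ , wi , _) sx≢sM ℓx<ℓc with opposite-inside c-opp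
      ... | k , m₁<k , _ , wk =
            ℕₚ.<-asym ℓx<ℓc (descending-around-peak wi wm₁ wk i<m₁ m₁<k
              (M-max _ (opposite⇒≢M sx≢sM)) (M-max _ c≢M) (label-<⇒≢ ℓx<ℓc))

      ¬straddles-m₂ : ∀ {x} → Straddles x m₂ → side x ≢ side M → ℓ a < ℓ x → ⊥
      ¬straddles-m₂ (_ , j , _ , m₂<j , _ , wj) sx≢sM ℓa<ℓx with opposite-inside a-opp
      ... | k , _ , k<m₂ , wk =
            ℕₚ.<-asym ℓa<ℓx (descending-around-peak wk wm₂ wj k<m₂ m₂<j
              (M-max _ a≢M) (M-max _ (opposite⇒≢M sx≢sM)) (label-<⇒≢ ℓa<ℓx))

      a-straddles-m₂ : Straddles a m₂
      a-straddles-m₂ with opposites-repeat a≢b a-opp b-opp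
      ... | inj₁ ra with repeated⇒straddles-m₁-or-m₂ ra a-opp
      ...   | inj₁ s = ⊥-elim (¬straddles-m₁ s a-opp ℓa<ℓc)
      ...   | inj₂ s = s
      a-straddles-m₂ | inj₂ rb with repeated⇒straddles-m₁-or-m₂ rb b-opp
      ...   | inj₁ s = ⊥-elim (¬straddles-m₁ s b-opp ℓb<ℓc)
      ...   | inj₂ s = ⊥-elim (¬straddles-m₂ s b-opp ℓa<ℓb)

      c-straddles-m₁ : Straddles c m₁
      c-straddles-m₁ with opposites-repeat b≢c b-opp c-opp
      ... | inj₂ rc with repeated⇒straddles-m₁-or-m₂ rc c-opp
      ...   | inj₁ s = s
      ...   | inj₂ s = ⊥-elim (¬straddles-m₂ s c-opp ℓa<ℓc)
      c-straddles-m₁ | inj₁ rb with repeated⇒straddles-m₁-or-m₂ rb b-opp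
      ...   | inj₁ s = ⊥-elim (¬straddles-m₁ s b-opp ℓb<ℓc)
      ...   | inj₂ s = ⊥-elim (¬straddles-m₂ s b-opp ℓa<ℓb)

      -- A letter v on M's side alternates with a and c, so an occurrence of v before m₁
      -- would make v straddle m₁ together with c, and one after m₂ would make it straddle m₂
      -- together with a.
      mate-occurs-inside : ∀ {v r} → side v ≡ side M → v ≢ M → w[ r ] ≡ v → Inside r
      mate-occurs-inside {v} {r} sv≡sM v≢M wr = after-m₁ , before-m₂
        where
        after-m₁ : m₁ <ᶠ r
        after-m₁ with Finₚ.<-cmp r m₁
        ... | tri≈ _ r≡m₁ _ = ⊥-elim (not-at-m₁ wr v≢M r≡m₁)
        ... | tri> _ _ m₁<r = m₁<r
        ... | tri< r<m₁ _ _ with opposite-inside a-opp | a-straddles-m₂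
        ... | k , m₁<k , k<m₂ , wk | _ , j , _ , m₂<j , _ , wj
              with proj₁ (alternate (opposite-sides sv≡sM a-opp)) k j (Finₚ.<-trans k<m₂ m₂<j) wk wj
        ... | π , k<π , _ , wπ =
              ⊥-elim (no-two-straddlers-of-M (r , π , r<m₁ , Finₚ.<-trans m₁<k k<π , wr , wπ)
                        c-straddles-m₁ wm₁ v≢M c≢M (mate≢opposite sv≡sM c-opp))

        before-m₂ : r <ᶠ m₂
        before-m₂ with Finₚ.<-cmp r m₂
        ... | tri≈ _ r≡m₂ _ = ⊥-elim (not-at-m₂ wr v≢M r≡m₂)
        ... | tri< r<m₂ _ _ = r<m₂
        ... | tri> _ _ m₂<r with c-straddles-m₁ | opposite-inside c-opp
        ... | i , _ , i<m₁ , _ , wi , _ | k , m₁<k , k<m₂ , wk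
              with proj₁ (alternate (opposite-sides sv≡sM c-opp)) i k (Finₚ.<-trans i<m₁ m₁<k) wi wk
        ... | π , _ , π<k , wπ =
              ⊥-elim (no-two-straddlers-of-M (π , r , Finₚ.<-trans π<k k<m₂ , m₂<r , wπ , wr)
                        a-straddles-m₂ wm₂ v≢M a≢M (mate≢opposite sv≡sM a-opp))

      mate-repeated : ∀ {v} → side v ≡ side M → v ≢ M → Repeated v
      mate-repeated {v} sv≡sM v≢M with ¬alternate⇒unseparated (¬alternate v≢M sv≡sM)
      ... | inj₁ (r₁ , r₂ , r₁<r₂ , wr₁ , wr₂ , _) = r₁ , r₂ , r₁<r₂ , wr₁ , wr₂
      ... | inj₂ (i , j , i<j , wi , wj , no-v-between) with only i wi | only j wj
      ... | inj₁ refl | inj₁ refl = ⊥-elim (Finₚ.<-irrefl refl i<j)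
      ... | inj₂ refl | inj₂ refl = ⊥-elim (Finₚ.<-irrefl refl i<j)
      ... | inj₂ refl | inj₁ refl = ⊥-elim (Finₚ.<-asym i<j m₁<m₂)
      ... | inj₁ refl | inj₂ refl with occurrence (occurs v)
      ... | r , wr with mate-occurs-inside sv≡sM v≢M wr
      ... | m₁<r , r<m₂ = ⊥-elim (no-v-between (r , m₁<r , r<m₂ , wr))

      below-c : ∀ {v r} → w[ r ] ≡ v → m₁ <ᶠ r → v ≢ M → v ≢ c → ℓ v < ℓ c
      below-c wr m₁<r v≢M v≢c with c-straddles-m₁
      ... | i , _ , i<m₁ , _ , wi , _ =
            descending-around-peak wi wm₁ wr i<m₁ m₁<r (M-max _ c≢M) (M-max _ v≢M)
              (λ c≡v → v≢c (sym c≡v))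

      impossible : ⊥
      impossible
        with mate-repeated p-same p≢M | mate-repeated q-same q≢M
      ... | r₁ , r₂ , r₁<r₂ , wr₁ , wr₂ | s₁ , s₂ , s₁<s₂ , ws₁ , ws₂
        with proj₁ (alternate (≢-sym (opposite-sides p-same c-opp))) r₁ r₂ r₁<r₂ wr₁ wr₂
           | proj₁ (alternate (≢-sym (opposite-sides q-same c-opp))) s₁ s₂ s₁<s₂ ws₁ ws₂
      ... | γ , r₁<γ , γ<r₂ , wγ | γ′ , s₁<γ′ , γ′<s₂ , wγ′
        with opposite-inside-unique c-opp wγ wγ′
               (inside-between (mate-occurs-inside p-same p≢M wr₁) r₁<γ γ<r₂
                               (mate-occurs-inside p-same p≢M wr₂))
               (inside-between (mate-occurs-inside q-same q≢M ws₁) s₁<γ′ γ′<s₂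
                               (mate-occurs-inside q-same q≢M ws₂))
      ... | refl =
            no-two-lower-straddlers (r₁ , r₂ , r₁<γ , γ<r₂ , wr₁ , wr₂)
              (s₁ , s₂ , s₁<γ′ , γ′<s₂ , ws₁ , ws₂) wγ
              (below-c wr₁ (proj₁ (mate-occurs-inside p-same p≢M wr₁)) p≢M (mate≢opposite p-same c-opp))
              (below-c ws₁ (proj₁ (mate-occurs-inside q-same q≢M ws₁)) q≢M (mate≢opposite q-same c-opp))
              p≢q

    impossible : ⊥
    impossible with once-or-twice (occurs M) M-occurs-at-most-twice
    ... | inj₁ (m , once) = Once.impossible once
    ... | inj₂ (m₁ , m₂ , m₁<m₂ , wm₁ , wm₂ , only) = Twice.impossible m₁<m₂ wm₁ wm₂ only

sort-by-label : ∀ {V : Set} {ℓ : V → ℕ} → Injective _≡_ _≡_ ℓ → (P : V → Set) →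
  ∀ {x y z} → x ≢ y → y ≢ z → x ≢ z → P x → P y → P z →
  ∃[ a ] ∃[ b ] ∃[ c ] (P a × P b × P c × ℓ a < ℓ b × ℓ b < ℓ c)
sort-by-label {ℓ = ℓ} ℓ-inj P {x} {y} {z} x≢y y≢z x≢z px py pz
  with ℕₚ.<-cmp (ℓ x) (ℓ y) | ℕₚ.<-cmp (ℓ y) (ℓ z) | ℕₚ.<-cmp (ℓ x) (ℓ z)
... | tri≈ _ e _ | _          | _          = ⊥-elim (x≢y (ℓ-inj e))
... | _          | tri≈ _ e _ | _          = ⊥-elim (y≢z (ℓ-inj e))
... | _          | _          | tri≈ _ e _ = ⊥-elim (x≢z (ℓ-inj e))
... | tri< x<y _ _ | tri< y<z _ _ | _            = x , y , z , px , py , pz , x<y , y<z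
... | tri< x<y _ _ | tri> _ _ z<y | tri< x<z _ _ = x , z , y , px , pz , py , x<z , z<y
... | tri< x<y _ _ | tri> _ _ z<y | tri> _ _ z<x = z , x , y , pz , px , py , z<x , x<y
... | tri> _ _ y<x | tri< y<z _ _ | tri< x<z _ _ = y , x , z , py , px , pz , y<x , x<z
... | tri> _ _ y<x | tri< y<z _ _ | tri> _ _ z<x = y , z , x , py , pz , px , y<z , z<x
... | tri> _ _ y<x | tri> _ _ z<y | _            = z , y , x , pz , py , px , z<y , y<x

maximal-label : ∀ {n} (ℓ : Fin n → ℕ) → Injective _≡_ _≡_ ℓ → Fin n →
  ∃[ M ] (∀ v → v ≢ M → ℓ v < ℓ M)
maximal-label {n} ℓ ℓ-inj v₀ = argmax ℓ v₀ (allFin n) , λ v v≢M →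
  ℕₚ.≤∧≢⇒< (All.lookup (f[xs]≤f[argmax] v₀ (allFin n)) (∈-allFin v))
            (λ ℓv≡ℓM → v≢M (ℓ-inj ℓv≡ℓM))

side : Fin 6 → Bool
side v = toℕ v <ᵇ 3

K₃,₃ : Graph
K₃,₃ = record
  { n      = 6
  ; Adj    = λ x y → side x ≢ side y
  ; sym    = ≢-sym
  ; irrefl = λ sx≢sx → sx≢sx refl
  }

-- The chords [v, 8 - v] (v < 3) are nested, as are [v, 14 - v] (3 ≤ v < 6), and every chord
-- of one family crosses every chord of the other.
chord-end : Fin 6 → ℕ
chord-end v = if side v then 8 ∸ toℕ v else 14 ∸ toℕ v

interleave? : ∀ a b c d → Dec (Interleave a b c d)
interleave? a b c d = (a <? c ×-dec c <? b ×-dec b <? d) ⊎-dec (c <? a ×-dec a <? d ×-dec d <? b)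

K₃,₃-chords : IsCircleGraph K₃,₃
K₃,₃-chords = record
  { left                = toℕ
  ; right               = chord-end
  ; ordered             = from-yes (Finₚ.all? λ v → toℕ v <? chord-end v)
  ; left-inj            = Finₚ.toℕ-injective
  ; right-inj           = λ {x} {y} → right-inj x y
  ; left-right-distinct = left≢right
  ; correct             = λ x y _ → let (to , from) = crossing x y in mk⇔ to from
  }
  where
  left≢right : (u v : Fin 6) → toℕ u ≢ chord-end v
  left≢right = from-yes (Finₚ.all? λ (u : Fin 6) → Finₚ.all? λ v → ¬? (toℕ u ℕₚ.≟ chord-end v))

  right-inj : ∀ x y → chord-end x ≡ chord-end y → x ≡ y
  right-inj = from-yes (Finₚ.all? λ x → Finₚ.all? λ y →
    (chord-end x ℕₚ.≟ chord-end y) →-dec (x Finₚ.≟ y))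

  Crossing : Fin 6 → Fin 6 → Set
  Crossing x y = Interleave (toℕ x) (chord-end x) (toℕ y) (chord-end y)

  crossing : ∀ x y → (side x ≢ side y → Crossing x y) × (Crossing x y → side x ≢ side y)
  crossing = from-yes (Finₚ.all? λ x → Finₚ.all? λ y →
    let sides? = ¬? (side x ≟ side y)
        crossing? = interleave? (toℕ x) (chord-end x) (toℕ y) (chord-end y)
    in (sides? →-dec crossing?) ×-dec (crossing? →-dec sides?))

mates : ∀ M → ∃₂ λ p q →
  p ≢ q × p ≢ M × q ≢ M × side p ≡ side M × side q ≡ side M
mates = from-yes (Finₚ.all? λ M → Finₚ.any? λ p → Finₚ.any? λ q →
  ¬? (p Finₚ.≟ q) ×-dec ¬? (p Finₚ.≟ M) ×-dec ¬? (q Finₚ.≟ M) ×-dec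
  (side p ≟ side M) ×-dec (side q ≟ side M))

opposites : ∀ M → ∃[ x ] ∃[ y ] ∃[ z ]
  (x ≢ y × y ≢ z × x ≢ z × side x ≢ side M × side y ≢ side M × side z ≢ side M)
opposites = from-yes (Finₚ.all? λ M → Finₚ.any? λ x → Finₚ.any? λ y → Finₚ.any? λ z →
  ¬? (x Finₚ.≟ y) ×-dec ¬? (y Finₚ.≟ z) ×-dec ¬? (x Finₚ.≟ z) ×-dec
  ¬? (side x ≟ side M) ×-dec ¬? (side y ≟ side M) ×-dec ¬? (side z ≟ side M))

K₃,₃-not-132-representable : ¬ Representable pattern132 K₃,₃
K₃,₃-not-132-representable (ℓ , ℓ-inj , w , (occurs , alternate⇔) , avoid) =
  let M , M-max = maximal-label ℓ ℓ-inj zero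
      p , q , p≢q , p≢M , q≢M , p-same , q-same = mates M
      x , y , z , x≢y , y≢z , x≢z , x-opp , y-opp , z-opp = opposites M
      a , b , c , a-opp , b-opp , c-opp , ℓa<ℓb , ℓb<ℓc =
        sort-by-label ℓ-inj (λ v → side v ≢ side M) x≢y y≢z x≢z x-opp y-opp z-opp
  in CompleteBipartite.Configuration.impossible Finₚ._≟_ side ℓ ℓ-inj w occurs alternate⇔ avoid
       M-max ℓa<ℓb ℓb<ℓc a-opp b-opp c-opp p≢q p≢M q≢M p-same q-same

theorem5p1 : ∃[ G ] (IsCircleGraph G × ¬ Representable pattern132 G)
theorem5p1 = K₃,₃ , K₃,₃-chords , K₃,₃-not-132-representable
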